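{- Let $n\ge s\ge0$ be integers with $s>4n/11$, let $G\in\mathfrak{E}(n,s)$, and let $(\varphi,\psi)$ be a $K_{1,3}$-mould for $G$. Then $\{\varphi(v)\colon v\in V(K_{1,3})\}$ dominates $V(\mathcal{F}_G)$, i.e., every vertex of $\mathcal{F}_G$ either belongs to this set or is adjacent in $\mathcal{F}_G$ to some element of it.
   Context: All graphs are finite and simple. For integers $n\ge s\ge 0$, $\mathrm{ex}(n,s)$ is the maximum number of edges in a triangle-free graph on $n$ vertices with independence number at most $s$, and $\mathfrak{E}(n,s)$ is the family of triangle-free graphs $G$ on $n$ vertices with $\alpha(G)\le s$ and exactly $\mathrm{ex}(n,s)$ edges. $K_{1,3}$ is the star with one centre and three leaves. The fortress $\mathcal{F}_G$ of $G\in\mathfrak{E}(n,s)$ is the graph whose vertices are the independent sets $X\subseteq V(G)$ with $|X|=s$, two such sets being adjacent iff they are disjoint. An imprint of a graph $H$ in $G$ is an injective map $\varphi\colon V(H)\to V(\mathcal{F}_G)$ such that for all $x,y\in V(H)$: $xy\in E(H)$ iff $\varphi(x)\varphi(y)\in E(\mathcal{F}_G)$. An $H$-mould for $G$ is a pair $(\varphi,\psi)$ of maps $V(H)\to\mathcal{P}(V(G))$ such that $\varphi$ is an imprint of $H$ in $G$ and for every $x\in V(H)$, $\psi(x)$ is an independent set of size $3s-n$ in $G$ and every vertex of $\psi(x)$ is adjacent to every vertex of $\varphi(x)$. -}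

module Defs where

open import Data.Nat using (ℕ; _+_; _<_; _≤_; _∸_; _*_)
open import Data.Bool using (Bool; true; false; if_then_else_)
open import Data.Fin using (Fin; toℕ; zero)
open import Data.Fin.Subset using (Subset; _∈_; ∣_∣)
open import Data.List using (List; map; filter; allFin)
open import Data.Nat.ListAction using (sum)
open import Data.Product using (_×_; Σ; ∃-syntax)
open import Data.Sum using (_⊎_)
open import Data.Empty using (⊥)
open import Relation.Nullary using (¬_)
open import Relation.Binary.PropositionalEquality using (_≡_; _≢_)
open import Data.Nat using (_<?_)
open import Function.Definitions using (Injective)

record Graph (n : ℕ) : Set where
  field
    adj     : Fin n → Fin n → Bool
    sym     : ∀ i j → adj i j ≡ adj j i
    irrefl  : ∀ i → adj i i ≡ false
open Graph public

edgeCount : ∀ {n} → Graph n → ℕ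
edgeCount {n} G =
  sum (map (λ i → sum (map (λ j → if adj G i j then 1 else 0)
                            (filter (λ j → toℕ i <? toℕ j) (allFin n))))
           (allFin n))

TriangleFree : ∀ {n} → Graph n → Set
TriangleFree {n} G = ∀ (i j k : Fin n) →
  ¬ (adj G i j ≡ true × adj G j k ≡ true × adj G i k ≡ true)

Independent : ∀ {n} → Graph n → Subset n → Set
Independent {n} G X = ∀ (i j : Fin n) → i ∈ X → j ∈ X → adj G i j ≡ false

IndepAtMost : ∀ {n} → Graph n → ℕ → Set
IndepAtMost {n} G s = ∀ (X : Subset n) → Independent G X → ∣ X ∣ ≤ s

-- G ∈ 𝔈(n,s): triangle-free, α(G) ≤ s, and edge-maximum among such graphs
-- (i.e. it has exactly ex(n,s) edges).
InE : (n s : ℕ) → Graph n → Set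
InE n s G = TriangleFree G × IndepAtMost G s ×
  (∀ (H : Graph n) → TriangleFree H → IndepAtMost H s → edgeCount H ≤ edgeCount G)

Disjoint : ∀ {n} → Subset n → Subset n → Set
Disjoint {n} X Y = ∀ (i : Fin n) → i ∈ X → i ∈ Y → ⊥

FortressVertex : ∀ {n} → Graph n → ℕ → Subset n → Set
FortressVertex G s X = Independent G X × ∣ X ∣ ≡ s

-- Adjacency in the fortress: disjointness (for distinct vertices).
FortressAdj : ∀ {n} → Subset n → Subset n → Set
FortressAdj X Y = Disjoint X Y

K13Adj : Fin 4 → Fin 4 → Set
K13Adj x y = x ≢ y × (x ≡ zero ⊎ y ≡ zero)

-- Imprint of K_{1,3} in G (F_G is a simple graph, so the "iff" condition is
-- imposed for distinct x, y).
K13Imprint : ∀ {n} → Graph n → ℕ → (Fin 4 → Subset n) → Set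
K13Imprint G s φ =
  Injective _≡_ _≡_ φ ×
  (∀ x → FortressVertex G s (φ x)) ×
  (∀ x y → x ≢ y → (K13Adj x y → FortressAdj (φ x) (φ y)) ×
                    (FortressAdj (φ x) (φ y) → K13Adj x y))

K13Mould : ∀ {n} → Graph n → ℕ → (Fin 4 → Subset n) → (Fin 4 → Subset n) → Set
K13Mould {n} G s φ ψ =
  K13Imprint G s φ ×
  (∀ x → Independent G (ψ x) × ∣ ψ x ∣ ≡ (3 * s) ∸ n ×
         (∀ (u w : Fin n) → u ∈ ψ x → w ∈ φ x → adj G u w ≡ true))

-- Let A = φ(centre) and let X be an independent s-set meeting every φ(v).  In a
-- triangle-free graph with α ≤ s, a vertex complete to an independent s-set Y has
-- all its neighbours in Y.  Hence each ψ(v) avoids X, the three leaf sets ψ(l) are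
-- pairwise disjoint and, since leaves meet, pairwise anticomplete; they are also
-- anticomplete to A, while ψ(centre) is anticomplete to X ∖ A.  So both
-- ψ(centre) ∪ (X ∖ A) and ψ(l₁) ∪ ψ(l₂) ∪ ψ(l₃) ∪ (X ∩ A) are independent, and
-- adding their sizes gives 4(3s − n) + s ≤ 2s, i.e. 11s ≤ 4n.
module Submission where

open import Defs
open import Data.Nat using (ℕ; _≤_; _<_; _*_)
open import Data.Fin using (Fin)
open import Data.Fin.Subset using (Subset)
open import Data.Product using (_×_; ∃-syntax)
open import Data.Sum using (_⊎_)
open import Relation.Binary.PropositionalEquality using (_≡_)

open import Data.Nat using (suc; _+_; _∸_)
open import Data.Nat.Properties
  using (+-suc; +-comm; +-identityʳ; +-mono-≤; +-monoʳ-≤; +-cancelʳ-≤; *-monoʳ-≤;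
         *-distribˡ-+; m≤n+m∸n; <⇒≱; <-irrefl; module ≤-Reasoning)
open import Data.Nat.Tactic.RingSolver using (solve-∀)
open import Data.Bool using (true; false)
import Data.Bool as Bool
open import Data.Bool.Properties using (¬-not; not-¬)
open import Data.Vec.Base using ([]; _∷_; here; there)
open import Data.Fin using (zero; suc; _≟_)
open import Data.Fin.Properties using (any?; ¬∀⟶∃¬)
open import Data.Fin.Subset using (_∈_; _∉_; _⊆_; ∣_∣; _∪_; _∩_; ∁; ⁅_⁆; Nonempty; inside; outside)
open import Data.Fin.Subset.Properties
  using (_∈?_; nonempty?; x∈p∪q⁻; x∈p∩q⁺; x∈p∩q⁻; p∩q⊆p; p∩q⊆q; x∈∁p⇒x∉p; x∉p⇒x∈∁p;
         x∈⁅y⁆⇒x≡y; ∣⁅x⁆∣≡1; ⊆-antisym)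
open import Data.Product using (_,_; proj₁; proj₂)
open import Data.Empty using (⊥-elim)
open import Data.Sum using (inj₁; inj₂; [_,_]′)
open import Function using (id; _∘_)
open import Function.Definitions using (Injective)
open import Relation.Nullary using (¬_; yes; no; contradiction)
open import Relation.Nullary.Decidable using (_×-dec_)
open import Relation.Binary.PropositionalEquality
  using (_≢_; refl; cong; cong₂; trans; subst; ≢-sym; module ≡-Reasoning)
  renaming (sym to ≡-sym)

drop-∷-Disjoint : ∀ {n} {x y} {p q : Subset n} → Disjoint (x ∷ p) (y ∷ q) → Disjoint p q
drop-∷-Disjoint d i i∈p i∈q = d (suc i) (there i∈p) (there i∈q)

¬Nonempty-∩⇒Disjoint : ∀ {n} {p q : Subset n} → ¬ Nonempty (p ∩ q) → Disjoint p q
¬Nonempty-∩⇒Disjoint ¬meet i i∈p i∈q = ¬meet (i , x∈p∩q⁺ (i∈p , i∈q))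

Disjoint-∪ʳ : ∀ {n} {p q r : Subset n} → Disjoint p q → Disjoint p r → Disjoint p (q ∪ r)
Disjoint-∪ʳ {q = q} {r} d e i i∈p i∈q∪r = [ d i i∈p , e i i∈p ]′ (x∈p∪q⁻ q r i∈q∪r)

∣p∪q∣≡∣p∣+∣q∣ : ∀ {n} {p q : Subset n} → Disjoint p q → ∣ p ∪ q ∣ ≡ ∣ p ∣ + ∣ q ∣
∣p∪q∣≡∣p∣+∣q∣ {p = []}          {[]}          _ = refl
∣p∪q∣≡∣p∣+∣q∣ {p = inside  ∷ p} {inside  ∷ q} d = contradiction here (d zero here)
∣p∪q∣≡∣p∣+∣q∣ {p = inside  ∷ p} {outside ∷ q} d = cong suc (∣p∪q∣≡∣p∣+∣q∣ (drop-∷-Disjoint d))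
∣p∪q∣≡∣p∣+∣q∣ {p = outside ∷ p} {inside  ∷ q} d =
  trans (cong suc (∣p∪q∣≡∣p∣+∣q∣ (drop-∷-Disjoint d))) (≡-sym (+-suc ∣ p ∣ ∣ q ∣))
∣p∪q∣≡∣p∣+∣q∣ {p = outside ∷ p} {outside ∷ q} d = ∣p∪q∣≡∣p∣+∣q∣ (drop-∷-Disjoint d)

∣p∩q∣+∣p∩∁q∣≡∣p∣ : ∀ {n} (p q : Subset n) → ∣ p ∩ q ∣ + ∣ p ∩ ∁ q ∣ ≡ ∣ p ∣
∣p∩q∣+∣p∩∁q∣≡∣p∣ []            []            = refl
∣p∩q∣+∣p∩∁q∣≡∣p∣ (outside ∷ p) (_       ∷ q) = ∣p∩q∣+∣p∩∁q∣≡∣p∣ p q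
∣p∩q∣+∣p∩∁q∣≡∣p∣ (inside  ∷ p) (inside  ∷ q) = cong suc (∣p∩q∣+∣p∩∁q∣≡∣p∣ p q)
∣p∩q∣+∣p∩∁q∣≡∣p∣ (inside  ∷ p) (outside ∷ q) =
  trans (+-suc ∣ p ∩ q ∣ ∣ p ∩ ∁ q ∣) (cong suc (∣p∩q∣+∣p∩∁q∣≡∣p∣ p q))

Anticomplete : ∀ {n} → Graph n → Subset n → Subset n → Set
Anticomplete {n} G P Q = ∀ (i j : Fin n) → i ∈ P → j ∈ Q → adj G i j ≡ false

Complete : ∀ {n} → Graph n → Subset n → Subset n → Set
Complete {n} G P Q = ∀ (i j : Fin n) → i ∈ P → j ∈ Q → adj G i j ≡ true

module AnticompleteProperties {n} (G : Graph n) where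

  Anticomplete-sym : {P Q : Subset n} → Anticomplete G P Q → Anticomplete G Q P
  Anticomplete-sym a i j i∈Q j∈P = trans (sym G i j) (a j i j∈P i∈Q)

  Anticomplete-⊆ : {P P′ Q Q′ : Subset n} → P′ ⊆ P → Q′ ⊆ Q →
                   Anticomplete G P Q → Anticomplete G P′ Q′
  Anticomplete-⊆ P′⊆P Q′⊆Q a i j i∈ j∈ = a i j (P′⊆P i∈) (Q′⊆Q j∈)

  Anticomplete-∪ˡ : {P Q R : Subset n} → Anticomplete G P R → Anticomplete G Q R →
                    Anticomplete G (P ∪ Q) R
  Anticomplete-∪ˡ {P} {Q} a b i j i∈P∪Q j∈R =
    [ (λ i∈P → a i j i∈P j∈R) , (λ i∈Q → b i j i∈Q j∈R) ]′ (x∈p∪q⁻ P Q i∈P∪Q)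

  Anticomplete-∪ʳ : {P Q R : Subset n} → Anticomplete G P Q → Anticomplete G P R →
                    Anticomplete G P (Q ∪ R)
  Anticomplete-∪ʳ a b = Anticomplete-sym (Anticomplete-∪ˡ (Anticomplete-sym a) (Anticomplete-sym b))

  -- Independent G P is, by definition, Anticomplete G P P.
  Independent-∪ : {P Q : Subset n} → Independent G P → Independent G Q →
                  Anticomplete G P Q → Independent G (P ∪ Q)
  Independent-∪ iP iQ a =
    Anticomplete-∪ˡ (Anticomplete-∪ʳ iP a) (Anticomplete-∪ʳ (Anticomplete-sym a) iQ)

  Independent-⁅_⁆ : (b : Fin n) → Independent G ⁅ b ⁆
  Independent-⁅ b ⁆ i j i∈ j∈ rewrite x∈⁅y⁆⇒x≡y b i∈ | x∈⁅y⁆⇒x≡y b j∈ = irrefl G b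

module TriangleFreeGraph {n} {G : Graph n} (triangle-free : TriangleFree G) where

  open AnticompleteProperties G

  common-neighbour⇒nonadjacent : ∀ {u w c} → adj G u c ≡ true → adj G w c ≡ true →
                                 adj G u w ≡ false
  common-neighbour⇒nonadjacent {u} {w} {c} uc wc =
    ¬-not (λ uw → triangle-free u w c (uw , wc , uc))

  module _ {s} (α≤s : IndepAtMost G s) {Y : Subset n} (Y-vertex : FortressVertex G s Y) where

    maximum-independent-dominates : ∀ {b} → b ∉ Y → ∃[ c ] (c ∈ Y × adj G b c ≡ true)
    maximum-independent-dominates {b} b∉Y
      with any? (λ c → (c ∈? Y) ×-dec (adj G b c Bool.≟ true))
    ... | yes neighbour = neighbour
    ... | no no-neighbour = contradiction (subst (_≤ s) size (α≤s _ independent)) (<-irrefl refl)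
      where
        independent : Independent G (Y ∪ ⁅ b ⁆)
        independent = Independent-∪ (proj₁ Y-vertex) Independent-⁅ b ⁆
          λ i j i∈Y j∈b → subst (λ k → adj G i k ≡ false) (≡-sym (x∈⁅y⁆⇒x≡y b j∈b))
            (trans (sym G i b) (¬-not (λ bi → no-neighbour (i , i∈Y , bi))))
        size : ∣ Y ∪ ⁅ b ⁆ ∣ ≡ suc s
        size = begin
          ∣ Y ∪ ⁅ b ⁆ ∣     ≡⟨ ∣p∪q∣≡∣p∣+∣q∣ (λ i i∈Y i∈b → b∉Y (subst (_∈ Y) (x∈⁅y⁆⇒x≡y b i∈b) i∈Y)) ⟩
          ∣ Y ∣ + ∣ ⁅ b ⁆ ∣ ≡⟨ cong₂ _+_ (proj₂ Y-vertex) (∣⁅x⁆∣≡1 b) ⟩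
          s + 1             ≡⟨ +-comm s 1 ⟩
          suc s             ∎
          where open ≡-Reasoning

    complete⇒neighbours∈ : ∀ {P u b} → Complete G P Y → u ∈ P → adj G u b ≡ true → b ∈ Y
    complete⇒neighbours∈ {b = b} PY u∈P ub with b ∈? Y
    ... | yes b∈Y = b∈Y
    ... | no  b∉Y with maximum-independent-dominates b∉Y
    ...   | c , c∈Y , bc = contradiction (ub , bc , PY _ c u∈P c∈Y) (triangle-free _ b c)

    complete⇒anticomplete-∁ : ∀ {P} → Complete G P Y → Anticomplete G P (∁ Y)
    complete⇒anticomplete-∁ PY i j i∈P j∈∁Y =
      ¬-not (λ ij → x∈∁p⇒x∉p j∈∁Y (complete⇒neighbours∈ PY i∈P ij))

split-bounds⇒4*t≤s : ∀ a b t s → a + b ≡ s → b + t ≤ s → a + 3 * t ≤ s → 4 * t ≤ s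
split-bounds⇒4*t≤s a b t s a+b≡s b+t≤s a+3t≤s = +-cancelʳ-≤ s (4 * t) s (begin
  4 * t + s               ≡⟨ cong (4 * t +_) (≡-sym a+b≡s) ⟩
  4 * t + (a + b)         ≡⟨ rearrange a b t ⟩
  (b + t) + (a + 3 * t)   ≤⟨ +-mono-≤ b+t≤s a+3t≤s ⟩
  s + s                   ∎)
  where
    open ≤-Reasoning
    rearrange : ∀ a b t → 4 * t + (a + b) ≡ (b + t) + (a + 3 * t)
    rearrange = solve-∀

4*[3*s∸n]≤s⇒11*s≤4*n : ∀ n s → 4 * (3 * s ∸ n) ≤ s → 11 * s ≤ 4 * n
4*[3*s∸n]≤s⇒11*s≤4*n n s 4t≤s = +-cancelʳ-≤ s (11 * s) (4 * n) (begin
  11 * s + s              ≡⟨ twelvefold s ⟩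
  4 * (3 * s)             ≤⟨ *-monoʳ-≤ 4 (m≤n+m∸n (3 * s) n) ⟩
  4 * (n + (3 * s ∸ n))   ≡⟨ *-distribˡ-+ 4 n (3 * s ∸ n) ⟩
  4 * n + 4 * (3 * s ∸ n) ≤⟨ +-monoʳ-≤ (4 * n) 4t≤s ⟩
  4 * n + s               ∎)
  where
    open ≤-Reasoning
    twelvefold : ∀ s → 11 * s + s ≡ 4 * (3 * s)
    twelvefold = solve-∀

module K13MouldProperties {n s} {G : Graph n}
  (triangle-free : TriangleFree G) (α≤s : IndepAtMost G s)
  {φ ψ : Fin 4 → Subset n} (mould : K13Mould G s φ ψ) where

  open AnticompleteProperties G
  open TriangleFreeGraph {G = G} triangle-free

  φ-injective : Injective _≡_ _≡_ φ
  φ-injective = proj₁ (proj₁ mould)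

  φ-vertex : ∀ x → FortressVertex G s (φ x)
  φ-vertex = proj₁ (proj₂ (proj₁ mould))

  φ-adjacency : ∀ x y → x ≢ y →
                (K13Adj x y → FortressAdj (φ x) (φ y)) × (FortressAdj (φ x) (φ y) → K13Adj x y)
  φ-adjacency = proj₂ (proj₂ (proj₁ mould))

  ψ-independent : ∀ x → Independent G (ψ x)
  ψ-independent x = proj₁ (proj₂ mould x)

  ∣ψ∣≡3s∸n : ∀ x → ∣ ψ x ∣ ≡ 3 * s ∸ n
  ∣ψ∣≡3s∸n x = proj₁ (proj₂ (proj₂ mould x))

  ψ-complete : ∀ x → Complete G (ψ x) (φ x)
  ψ-complete x = proj₂ (proj₂ (proj₂ mould x))

  centre-disjoint-leaf : ∀ {l} → l ≢ zero → Disjoint (φ zero) (φ l)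
  centre-disjoint-leaf l≢0 = proj₁ (φ-adjacency zero _ (≢-sym l≢0)) (≢-sym l≢0 , inj₁ refl)

  leaves-meet : ∀ {l l′} → l ≢ l′ → l ≢ zero → l′ ≢ zero → Nonempty (φ l ∩ φ l′)
  leaves-meet {l} {l′} l≢l′ l≢0 l′≢0 with nonempty? (φ l ∩ φ l′)
  ... | yes meet = meet
  ... | no ¬meet = ⊥-elim
    ([ l≢0 , l′≢0 ]′ (proj₂ (proj₂ (φ-adjacency l l′ l≢l′) (¬Nonempty-∩⇒Disjoint ¬meet))))

  centre-anticomplete-ψ-leaf : ∀ {l} → l ≢ zero → Anticomplete G (φ zero) (ψ l)
  centre-anticomplete-ψ-leaf {l} l≢0 =
    Anticomplete-sym (Anticomplete-⊆ id (λ a∈ → x∉p⇒x∈∁p (centre-disjoint-leaf l≢0 _ a∈))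
      (complete⇒anticomplete-∁ α≤s (φ-vertex l) (ψ-complete l)))

  ψ-leaf-anticomplete-ψ-leaf : ∀ {l l′} → l ≢ zero → l′ ≢ zero → Anticomplete G (ψ l) (ψ l′)
  ψ-leaf-anticomplete-ψ-leaf {l} {l′} l≢0 l′≢0 with l ≟ l′
  ... | yes refl = ψ-independent l
  ... | no l≢l′ with leaves-meet l≢l′ l≢0 l′≢0
  ...   | c , c∈φl∩φl′ with x∈p∩q⁻ (φ l) (φ l′) c∈φl∩φl′
  ...     | c∈φl , c∈φl′ = λ i j i∈ψl j∈ψl′ →
    common-neighbour⇒nonadjacent (ψ-complete l i c i∈ψl c∈φl) (ψ-complete l′ j c j∈ψl′ c∈φl′)

  common-ψ⇒φ⊆ : ∀ {x y q} → q ∈ ψ x → q ∈ ψ y → φ x ⊆ φ y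
  common-ψ⇒φ⊆ {x} {y} q∈ψx q∈ψy b∈φx =
    complete⇒neighbours∈ α≤s (φ-vertex y) (ψ-complete y) q∈ψy (ψ-complete x _ _ q∈ψx b∈φx)

  ψ-disjoint : ∀ {x y} → x ≢ y → Disjoint (ψ x) (ψ y)
  ψ-disjoint x≢y q q∈ψx q∈ψy =
    x≢y (φ-injective (⊆-antisym (common-ψ⇒φ⊆ q∈ψx q∈ψy) (common-ψ⇒φ⊆ q∈ψy q∈ψx)))

  l₁ l₂ l₃ : Fin 4
  l₁ = suc zero
  l₂ = suc (suc zero)
  l₃ = suc (suc (suc zero))

  ψ-leaves : Subset n
  ψ-leaves = ψ l₁ ∪ ψ l₂ ∪ ψ l₃

  ∣ψ-leaves∣≡3*[3s∸n] : ∣ ψ-leaves ∣ ≡ 3 * (3 * s ∸ n)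
  ∣ψ-leaves∣≡3*[3s∸n] = begin
    ∣ ψ l₁ ∪ ψ l₂ ∪ ψ l₃ ∣            ≡⟨ ∣p∪q∣≡∣p∣+∣q∣ (Disjoint-∪ʳ (ψ-disjoint (λ ())) (ψ-disjoint (λ ()))) ⟩
    ∣ ψ l₁ ∣ + ∣ ψ l₂ ∪ ψ l₃ ∣        ≡⟨ cong (∣ ψ l₁ ∣ +_) (∣p∪q∣≡∣p∣+∣q∣ (ψ-disjoint (λ ()))) ⟩
    ∣ ψ l₁ ∣ + (∣ ψ l₂ ∣ + ∣ ψ l₃ ∣)  ≡⟨ cong₂ _+_ (∣ψ∣≡3s∸n l₁) (cong₂ _+_ (∣ψ∣≡3s∸n l₂) (∣ψ∣≡3s∸n l₃)) ⟩
    t + (t + t)                       ≡⟨ cong (λ k → t + (t + k)) (≡-sym (+-identityʳ t)) ⟩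
    3 * t                             ∎
    where
      open ≡-Reasoning
      t : ℕ
      t = 3 * s ∸ n

  ψ-leaves-independent : Independent G ψ-leaves
  ψ-leaves-independent = Independent-∪ (ψ-independent l₁)
    (Independent-∪ (ψ-independent l₂) (ψ-independent l₃) (ψ-leaf-anticomplete-ψ-leaf (λ ()) (λ ())))
    (Anticomplete-∪ʳ (ψ-leaf-anticomplete-ψ-leaf (λ ()) (λ ())) (ψ-leaf-anticomplete-ψ-leaf (λ ()) (λ ())))

  centre-anticomplete-ψ-leaves : Anticomplete G (φ zero) ψ-leaves
  centre-anticomplete-ψ-leaves = Anticomplete-∪ʳ (centre-anticomplete-ψ-leaf (λ ()))
    (Anticomplete-∪ʳ (centre-anticomplete-ψ-leaf (λ ())) (centre-anticomplete-ψ-leaf (λ ())))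

  module _ {X : Subset n} (X-vertex : FortressVertex G s X) (meets : ∀ v → Nonempty (X ∩ φ v)) where

    private
      A : Subset n
      A = φ zero

      t : ℕ
      t = 3 * s ∸ n

      X-independent : Independent G X
      X-independent = proj₁ X-vertex

    X-disjoint-ψ : ∀ v → Disjoint X (ψ v)
    X-disjoint-ψ v q q∈X q∈ψv with meets v
    ... | c , c∈X∩φv with x∈p∩q⁻ X (φ v) c∈X∩φv
    ...   | c∈X , c∈φv =
      contradiction (ψ-complete v q c q∈ψv c∈φv) (not-¬ (X-independent q c q∈X c∈X))

    outside-centre-bound : ∣ X ∩ ∁ A ∣ + t ≤ s
    outside-centre-bound = begin
      ∣ X ∩ ∁ A ∣ + t            ≡⟨ cong (∣ X ∩ ∁ A ∣ +_) (≡-sym (∣ψ∣≡3s∸n zero)) ⟩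
      ∣ X ∩ ∁ A ∣ + ∣ ψ zero ∣   ≡⟨ ≡-sym (∣p∪q∣≡∣p∣+∣q∣ (λ i i∈ → X-disjoint-ψ zero i (p∩q⊆p X (∁ A) i∈))) ⟩
      ∣ X ∩ ∁ A ∪ ψ zero ∣       ≤⟨ α≤s _ independent ⟩
      s                          ∎
      where
        open ≤-Reasoning
        independent : Independent G (X ∩ ∁ A ∪ ψ zero)
        independent = Independent-∪
          (Anticomplete-⊆ (p∩q⊆p X (∁ A)) (p∩q⊆p X (∁ A)) X-independent)
          (ψ-independent zero)
          (Anticomplete-⊆ (p∩q⊆q X (∁ A)) id
            (Anticomplete-sym (complete⇒anticomplete-∁ α≤s (φ-vertex zero) (ψ-complete zero))))

    inside-centre-bound : ∣ X ∩ A ∣ + 3 * t ≤ s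
    inside-centre-bound = begin
      ∣ X ∩ A ∣ + 3 * t            ≡⟨ cong (∣ X ∩ A ∣ +_) (≡-sym ∣ψ-leaves∣≡3*[3s∸n]) ⟩
      ∣ X ∩ A ∣ + ∣ ψ-leaves ∣     ≡⟨ ≡-sym (∣p∪q∣≡∣p∣+∣q∣ disjoint) ⟩
      ∣ X ∩ A ∪ ψ-leaves ∣         ≤⟨ α≤s _ independent ⟩
      s                            ∎
      where
        open ≤-Reasoning
        disjoint : Disjoint (X ∩ A) ψ-leaves
        disjoint = Disjoint-∪ʳ (restrict l₁) (Disjoint-∪ʳ (restrict l₂) (restrict l₃))
          where
            restrict : ∀ v → Disjoint (X ∩ A) (ψ v)
            restrict v i i∈ = X-disjoint-ψ v i (p∩q⊆p X A i∈)
        independent : Independent G (X ∩ A ∪ ψ-leaves)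
        independent = Independent-∪
          (Anticomplete-⊆ (p∩q⊆p X A) (p∩q⊆p X A) X-independent)
          ψ-leaves-independent
          (Anticomplete-⊆ (p∩q⊆q X A) id centre-anticomplete-ψ-leaves)

    11*s≤4*n : 11 * s ≤ 4 * n
    11*s≤4*n = 4*[3*s∸n]≤s⇒11*s≤4*n n s
      (split-bounds⇒4*t≤s _ _ t s (trans (∣p∩q∣+∣p∩∁q∣≡∣p∣ X A) (proj₂ X-vertex))
        outside-centre-bound inside-centre-bound)

  some-φ-disjoint : 4 * n < 11 * s → ∀ {X} → FortressVertex G s X → ∃[ v ] Disjoint X (φ v)
  some-φ-disjoint 4n<11s {X} X-vertex with ¬∀⟶∃¬ 4 (λ v → Nonempty (X ∩ φ v)) (λ v → nonempty? (X ∩ φ v))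
                                                   (<⇒≱ 4n<11s ∘ 11*s≤4*n X-vertex)
  ... | v , ¬meet = v , ¬Nonempty-∩⇒Disjoint ¬meet

fact4p3 : (n s : ℕ) → s ≤ n → 4 * n < 11 * s →
    (G : Graph n) → InE n s G →
    (φ ψ : Fin 4 → Subset n) → K13Mould G s φ ψ →
    (X : Subset n) → FortressVertex G s X →
    (∃[ v ] X ≡ φ v) ⊎ (∃[ v ] FortressAdj X (φ v))
fact4p3 n s _ 4n<11s G (triangle-free , α≤s , _) φ ψ mould X X-vertex =
  inj₂ (K13MouldProperties.some-φ-disjoint {G = G} triangle-free α≤s mould 4n<11s X-vertex)
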